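{- Let $G$ be a finite abelian group and $A\subseteq G$ with $\Gamma_3(A)=\Gamma_4(A)=G$. Fix an integer $k\ge 3$. Suppose there exists $\beta\in G$ such that $A$ contains at least $\lfloor (k-3)/2\rfloor+4$ pairwise disjoint unordered pairs $\{\alpha_1,\alpha_2\}\subseteq A$ with $\alpha_1+\alpha_2=\beta$. Then $\Gamma_k(A)=G$.
   Context: For $A\subseteq G$ and $0\le k\le|A|$, $\Gamma_k(A)=\{\alpha_1+\cdots+\alpha_k:\ \alpha_i\in A \text{ pairwise distinct}\}$. -}

module Defs where

open import Level using (Level; _⊔_)
open import Data.Nat using (ℕ; suc)
open import Data.Fin using (Fin)
import Data.Fin as Fin
open import Data.Product using (Σ; _×_; ∃)
open import Data.List using (List)
open import Relation.Binary.PropositionalEquality as ≡ using (_≡_)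
open import Relation.Nullary using (¬_)
open import Function.Bundles using (Bijection)
open import Algebra.Bundles using (AbelianGroup)
import Data.List.Membership.Setoid as SetoidMembership
import Algebra.Properties.Monoid.Sum as MonoidSum

IsFinite : ∀ {c ℓ} → AbelianGroup c ℓ → Set (c ⊔ ℓ)
IsFinite G = Σ ℕ λ n → Bijection (≡.setoid (Fin n)) (AbelianGroup.setoid G)

module _ {c ℓ} (G : AbelianGroup c ℓ) where
  open AbelianGroup G
  open SetoidMembership setoid using (_∈_)
  open MonoidSum monoid using (sum)

  InΓ : ℕ → List Carrier → Carrier → Set (c ⊔ ℓ)
  InΓ k A x = Σ (Fin k → Carrier) λ α →
                ((i : Fin k) → α i ∈ A)
              × ((i j : Fin k) → α i ≈ α j → i ≡ j)
              × (sum α ≈ x)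

  ΓFull : ℕ → List Carrier → Set (c ⊔ ℓ)
  ΓFull k A = (x : Carrier) → InΓ k A x

  -- Pair i is (p i 0, p i 1); injectivity of
  -- (i , t) ↦ p i t says the two elements of each pair are distinct and
  -- different pairs are disjoint.
  DisjointPairs : ℕ → List Carrier → Carrier → Set (c ⊔ ℓ)
  DisjointPairs m A β = Σ (Fin m → Fin 2 → Carrier) λ p →
                ((i : Fin m) (t : Fin 2) → p i t ∈ A)
              × ((i j : Fin m) (s t : Fin 2) → p i s ≈ p j t → (i ≡ j) × (s ≡ t))
              × ((i : Fin m) → p i Fin.zero ∙ p i (Fin.suc Fin.zero) ≈ β)

-- Write k = r + 2j with r ∈ {3, 4} and j = ⌊(k − 3)/2⌋, and let x ∈ G.
-- Since Γ_r(A) = G, the element x − jβ is a sum of r distinct elements of A.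
-- Each of these r elements lies in at most one of the disjoint β-pairs, so
-- at least j + 4 − r ≥ j of the pairs avoid them; adjoining j such pairs
-- gives x as a sum of r + 2j = k distinct elements of A.
module Submission where

open import Defs
open import Data.Nat using (ℕ; _≤_; _+_; _∸_; _/_)
open import Data.Product using (Σ; _×_)
open import Data.List using (List)
open import Algebra.Bundles using (AbelianGroup)

open import Algebra.Bundles using (Monoid)
import Algebra.Properties.Group as GroupProperties
import Algebra.Properties.Monoid.Sum as MonoidSum
open import Data.Empty using (⊥-elim)
open import Data.Fin using (Fin; zero; suc; splitAt; punchIn; inject≤)
open import Data.Fin.Properties
  using (+↔⊎; *↔×; punchIn-injective; punchInᵢ≢i; inject≤-injective; inj⇒≟)
  renaming (any? to anyFin?)
open import Data.Nat using (zero; suc; _<_; _*_; s≤s)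
open import Data.Nat.DivMod using (_%_; m≡m%n+[m/n]*n; m%n<n)
open import Data.Nat.Properties using (+-assoc; +-comm; +-monoˡ-≤; +-monoʳ-≤; ≤-pred; m+[n∸m]≡n; module ≤-Reasoning)
open import Data.Product using (_,_; proj₁; proj₂; ∃; uncurry)
open import Data.Sum using (inj₁; inj₂; [_,_])
open import Data.Sum.Properties using ([,]-map)
open import Data.Vec.Functional using (Vector; _++_; concat; head; tail; map; replicate)
open import Data.Vec.Functional.Relation.Unary.All.Properties using (++⁺)
open import Function.Base using (_∘_)
open import Function.Bundles using (Injection)
open import Function.Definitions using (Injective)
open import Function.Properties.Bijection using (Bijection⇒Inverse)
open import Function.Properties.Inverse using (Inverse⇒Injection)
import Function.Construct.Symmetry as Symmetry
open import Relation.Binary.Bundles using (Setoid)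
open import Relation.Binary.Definitions using (Decidable)
open import Relation.Binary.PropositionalEquality as ≡ using (_≡_; _≗_; cong; cong₂)
open import Relation.Nullary using (¬_; yes; no)
import Data.List.Membership.Setoid as SetoidMembership
import Relation.Binary.Reasoning.Setoid as SetoidReasoning

module _ {a} {A : Set a} where

  tail-++ : ∀ {m n} (xs : Vector A (suc m)) (ys : Vector A n) →
            tail (xs ++ ys) ≗ tail xs ++ ys
  tail-++ {m} xs ys i = [,]-map (splitAt m i)

  concat-suc : ∀ {m n} (xss : Vector (Vector A m) (suc n)) →
               concat xss ≗ head xss ++ concat (tail xss)
  concat-suc {m} xss i with splitAt m i
  ... | inj₁ _ = ≡.refl
  ... | inj₂ _ = ≡.refl

module _ {c ℓ} (M : Monoid c ℓ) where
  open Monoid M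
  open MonoidSum M using (sum; sum-cong-≗)
  open SetoidReasoning setoid

  sum-++ : ∀ {m n} (xs : Vector Carrier m) (ys : Vector Carrier n) →
           sum (xs ++ ys) ≈ sum xs ∙ sum ys
  sum-++ {zero}  xs ys = sym (identityˡ _)
  sum-++ {suc m} xs ys = begin
    head xs ∙ sum (tail (xs ++ ys))    ≡⟨ cong (head xs ∙_) (sum-cong-≗ (tail-++ xs ys)) ⟩
    head xs ∙ sum (tail xs ++ ys)      ≈⟨ ∙-congˡ (sum-++ (tail xs) ys) ⟩
    head xs ∙ (sum (tail xs) ∙ sum ys) ≈⟨ assoc _ _ _ ⟨
    sum xs ∙ sum ys                    ∎

  sum-concat : ∀ {m n} (xss : Vector (Vector Carrier m) n) →
               sum (concat xss) ≈ sum (map sum xss)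
  sum-concat {n = zero}  xss = refl
  sum-concat {n = suc n} xss = begin
    sum (concat xss)                         ≡⟨ sum-cong-≗ (concat-suc xss) ⟩
    sum (head xss ++ concat (tail xss))      ≈⟨ sum-++ (head xss) (concat (tail xss)) ⟩
    sum (head xss) ∙ sum (concat (tail xss)) ≈⟨ ∙-congˡ (sum-concat (tail xss)) ⟩
    sum (map sum xss)                        ∎

module _ {c ℓ} (S : Setoid c ℓ) where
  open Setoid S

  Disjoint : ∀ {i j} {I : Set i} {J : Set j} → (I → Carrier) → (J → Carrier) → Set _
  Disjoint f g = ∀ a b → ¬ f a ≈ g b

  injective-++ : ∀ {m n} {xs : Vector Carrier m} {ys : Vector Carrier n} →
                 Injective _≡_ _≈_ xs → Injective _≡_ _≈_ ys → Disjoint xs ys →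
                 Injective _≡_ _≈_ (xs ++ ys)
  injective-++ {m} {n} {xs} {ys} xs-inj ys-inj disjoint {i} {j} e =
    Injection.injective (Inverse⇒Injection (+↔⊎ {m} {n})) (sides (splitAt m i) (splitAt m j) e)
    where
    sides : ∀ u v → [ xs , ys ] u ≈ [ xs , ys ] v → u ≡ v
    sides (inj₁ a) (inj₁ b) e = cong inj₁ (xs-inj e)
    sides (inj₁ a) (inj₂ b) e = ⊥-elim (disjoint a b e)
    sides (inj₂ a) (inj₁ b) e = ⊥-elim (disjoint b a (sym e))
    sides (inj₂ a) (inj₂ b) e = cong inj₂ (ys-inj e)

  injective-concat : ∀ {m n} {xss : Vector (Vector Carrier m) n} →
                     Injective _≡_ _≈_ (uncurry xss) → Injective _≡_ _≈_ (concat xss)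
  injective-concat {m} {n} xss-inj = Injection.injective (Inverse⇒Injection (*↔× {n} {m})) ∘ xss-inj

  uncurry-injective : ∀ {m b} {xss : Fin m → Fin b → Carrier} →
                      (∀ i j s t → xss i s ≈ xss j t → i ≡ j × s ≡ t) →
                      Injective _≡_ _≈_ (uncurry xss)
  uncurry-injective xss-inj {i , s} {j , t} e with xss-inj i j s t e
  ... | ≡.refl , ≡.refl = ≡.refl

  injective-reindex : ∀ {m n b} {xss : Fin m → Fin b → Carrier} {ρ : Fin n → Fin m} →
                      Injective _≡_ _≡_ ρ → Injective _≡_ _≈_ (uncurry xss) →
                      Injective _≡_ _≈_ (uncurry (xss ∘ ρ))
  injective-reindex ρ-inj xss-inj e =
    cong₂ _,_ (ρ-inj (cong proj₁ (xss-inj e))) (cong proj₂ (xss-inj e))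

  module _ (_≟_ : Decidable _≈_) where

    block-avoidable : ∀ {m b} (xss : Fin (suc m) → Fin b → Carrier) →
                      Injective _≡_ _≈_ (uncurry xss) → (x : Carrier) →
                      ∃ λ i₀ → ∀ i t → ¬ xss (punchIn i₀ i) t ≈ x
    block-avoidable xss xss-inj x with anyFin? (λ i → anyFin? (λ t → xss i t ≟ x))
    ... | yes (i₀ , t₀ , x∈block) = i₀ , λ i t e →
            punchInᵢ≢i i₀ i (cong proj₁ (xss-inj {punchIn i₀ i , t} {i₀ , t₀} (trans e (sym x∈block))))
    ... | no  x∉blocks = zero , λ i t e → x∉blocks (suc i , t , e)

    -- Each xs i lies in at most one block, so discarding one block per
    -- element leaves m − n ≥ j blocks that avoid xs.
    blocks-avoiding : ∀ {n m b} j (xs : Fin n → Carrier) (xss : Fin m → Fin b → Carrier) →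
                      Injective _≡_ _≈_ (uncurry xss) → n + j ≤ m →
                      ∃ λ (ρ : Fin j → Fin m) → Injective _≡_ _≡_ ρ × Disjoint xs (uncurry (xss ∘ ρ))
    blocks-avoiding {zero} j xs xss xss-inj j≤m =
      (λ i → inject≤ i j≤m) , inject≤-injective j≤m j≤m _ _ , λ ()
    blocks-avoiding {suc n} j xs xss xss-inj (s≤s n+j≤m) with block-avoidable xss xss-inj (xs zero)
    ... | i₀ , avoids-x₀
        with blocks-avoiding j (xs ∘ suc) (xss ∘ punchIn i₀)
               (injective-reindex (punchIn-injective i₀ _ _) xss-inj) n+j≤m
    ... | ρ , ρ-inj , disjoint =
          punchIn i₀ ∘ ρ , ρ-inj ∘ punchIn-injective i₀ _ _ ,
          λ { zero (i , t) e → avoids-x₀ (ρ i) t (sym e) ; (suc a) b → disjoint a b }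

finite⇒decidable : ∀ {c ℓ} (G : AbelianGroup c ℓ) → IsFinite G → Decidable (AbelianGroup._≈_ G)
finite⇒decidable G (n , bij) = inj⇒≟ (Inverse⇒Injection (Symmetry.inverse (Bijection⇒Inverse bij)))

module _ {c ℓ} (G : AbelianGroup c ℓ) (_≟_ : Decidable (AbelianGroup._≈_ G))
         (A : List (AbelianGroup.Carrier G)) where
  open AbelianGroup G
  open GroupProperties group using (//-rightDividesˡ)
  open SetoidMembership setoid using (_∈_)
  open MonoidSum monoid using (sum; sum-cong-≋)
  open SetoidReasoning setoid

  ΓFull-+-pairs : ∀ r j {m β} → r + j ≤ m → ΓFull G r A → DisjointPairs G m A β →
                  ΓFull G (r + j * 2) A
  ΓFull-+-pairs r j {β = β} r+j≤m Γr (p , p∈A , p-disjoint , p-sum) x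
    with Γr (x ∙ sum (replicate j β) ⁻¹)
  ... | α , α∈A , α-distinct , α-sum
    with blocks-avoiding setoid _≟_ j α p (uncurry-injective setoid p-disjoint) r+j≤m
  ... | ρ , ρ-inj , α-avoids =
        α ++ concat q ,
        ++⁺ (_∈ A) α∈A (λ _ → p∈A _ _) ,
        (λ i i′ → injective-++ setoid (α-distinct _ _)
                    (injective-concat setoid
                      (injective-reindex setoid ρ-inj (uncurry-injective setoid p-disjoint)))
                    (λ a b → α-avoids a _) {i} {i′}) ,
        sum-q
    where
    q : Fin j → Fin 2 → Carrier
    q = p ∘ ρ
    sum-q : sum (α ++ concat q) ≈ x
    sum-q = begin
      sum (α ++ concat q)                  ≈⟨ sum-++ monoid α (concat q) ⟩
      sum α ∙ sum (concat q)               ≈⟨ ∙-cong α-sum (sum-concat monoid q) ⟩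
      (x ∙ sum (replicate j β) ⁻¹) ∙ sum (map sum q)
        ≈⟨ ∙-congˡ (sum-cong-≋ λ i → trans (∙-congˡ (identityʳ _)) (p-sum (ρ i))) ⟩
      (x ∙ sum (replicate j β) ⁻¹) ∙ sum (replicate j β) ≈⟨ //-rightDividesˡ _ x ⟩
      x                                    ∎

m≡n+[m∸n]%2+[m∸n]/2*2 : ∀ {m n} → n ≤ m → m ≡ n + (m ∸ n) % 2 + (m ∸ n) / 2 * 2
m≡n+[m∸n]%2+[m∸n]/2*2 {m} {n} n≤m = begin
  m                                   ≡⟨ m+[n∸m]≡n n≤m ⟨
  n + (m ∸ n)                         ≡⟨ cong (n +_) (m≡m%n+[m/n]*n (m ∸ n) 2) ⟩
  n + ((m ∸ n) % 2 + (m ∸ n) / 2 * 2) ≡⟨ +-assoc n _ _ ⟨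
  n + (m ∸ n) % 2 + (m ∸ n) / 2 * 2   ∎
  where open ≡.≡-Reasoning

proposition3p19 : ∀ {c ℓ} (G : AbelianGroup c ℓ) → IsFinite G →
    (A : List (AbelianGroup.Carrier G)) →
    ΓFull G 3 A → ΓFull G 4 A →
    (k : ℕ) → 3 ≤ k →
    Σ (AbelianGroup.Carrier G) (λ β → Σ ℕ (λ m →
      ((k ∸ 3) / 2 + 4 ≤ m) × DisjointPairs G m A β)) →
    ΓFull G k A
proposition3p19 G finite A Γ₃ Γ₄ k 3≤k (β , m , j+4≤m , pairs) =
  ≡.subst (λ n → ΓFull G n A) (≡.sym (m≡n+[m∸n]%2+[m∸n]/2*2 3≤k))
    (ΓFull-+-pairs G (finite⇒decidable G finite) A (3 + e) j 3+e+j≤m (Γ₃₊ e e<2) pairs)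
  where
  d e j : ℕ
  d = k ∸ 3
  e = d % 2
  j = d / 2
  e<2 : e < 2
  e<2 = m%n<n d 2
  Γ₃₊ : ∀ e → e < 2 → ΓFull G (3 + e) A
  Γ₃₊ 0 _ = Γ₃
  Γ₃₊ 1 _ = Γ₄
  Γ₃₊ (suc (suc _)) (s≤s (s≤s ()))
  3+e+j≤m : 3 + e + j ≤ m
  3+e+j≤m = begin
    3 + e + j ≤⟨ +-monoˡ-≤ j (+-monoʳ-≤ 3 (≤-pred e<2)) ⟩
    4 + j     ≡⟨ +-comm 4 j ⟩
    j + 4     ≤⟨ j+4≤m ⟩
    m         ∎
    where open ≤-Reasoning
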